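{- Let $\mathsf{K}$ be a prevariety of (generalized) quantales, let $\mathbf{M}$ be a pomonoid, and let $X$ be an $\mathbf{M}$-poset, with action determined by the pomonoid homomorphism $h\colon\mathbf{M}\to\mathrm{Mon}\,X$. Let $\eta_X\colon X\to F_{\mathsf{K}}(X)$ be the $\mathsf{K}$-free (generalized) quantale over $X$. Then $F_{\mathsf{K}}(X)$ is an $\mathbf{M}$-act determined by the unique map $h^{\sharp}\colon \mathbf{M}\to\mathrm{End}\,F_{\mathsf{K}}(X)$ such that $h^{\sharp}(a)(\eta_X(x))=\eta_X(h(a)(x))$ for all $a\in\mathbf{M}$ and $x\in X$.
   Context: Fix one of two parallel settings: in the plain setting "joins" means joins of arbitrary families; in the generalized setting joins of non-empty families only. A (generalized) quantale is $\mathbf{Q}=\langle Q,\bigvee,+,\mathsf{0}\rangle$ where $Q$ is a poset with all such joins, $\langle Q,+,\mathsf{0}\rangle$ is a monoid with $+$ order-preserving, and $+$ distributes over such joins on both sides; homomorphisms preserve such joins, $+$ and $\mathsf{0}$. A prevariety of (generalized) quantales is a class closed under isomorphic images, subalgebras and products. The $\mathsf{K}$-free (generalized) quantale over a poset $X$ is $F_{\mathsf{K}}(X)\in\mathsf{K}$ with an order-preserving map $\eta_X\colon X\to F_{\mathsf{K}}(X)$ such that every order-preserving map $g\colon X\to Q$ into (the poset reduct of) some $\mathbf{Q}\in\mathsf{K}$ factors as $g=g^{\sharp}\circ\eta_X$ for a unique homomorphism $g^{\sharp}\colon F_{\mathsf{K}}(X)\to\mathbf{Q}$. A pomonoid is a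 monoid with a partial order making multiplication order-preserving in each coordinate. $\mathrm{Mon}\,X$ is the pomonoid of order-preserving maps $X\to X$ with pointwise order, composition and identity; an $\mathbf{M}$-poset is a poset $X$ with a pomonoid homomorphism $\mathbf{M}\to\mathrm{Mon}\,X$ (equivalently an action $\ast\colon M\times X\to X$ order-preserving in both coordinates with $(ab)\ast x=a\ast(b\ast x)$, $1\ast x=x$). $\mathrm{End}\,\mathbf{Q}$ is the pomonoid of (generalized) quantale endomorphisms of $\mathbf{Q}$ under composition, ordered pointwise; an $\mathbf{M}$-act is a (generalized) quantale $\mathbf{Q}$ with a pomonoid homomorphism $\mathbf{M}\to\mathrm{End}\,\mathbf{Q}$. -}

module Defs where

open import Level using (Level; _⊔_; suc; Lift; lift)
open import Data.Bool using (Bool; true; false)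
open import Data.Unit.Polymorphic using (⊤; tt)
open import Data.Product using (Σ; _,_; proj₁; proj₂; _×_)
open import Function using (_∘_; id)
open import Relation.Binary.Core using (Rel)
open import Relation.Binary.Structures using (IsPartialOrder; IsPreorder; IsEquivalence)
open import Relation.Binary.Bundles using (Poset)
open import Algebra.Core using (Op₂)
open import Algebra.Structures using (IsMonoid; IsSemigroup; IsMagma)

-- The two parallel settings.
-- plain       : joins of arbitrary families (indexed by any I : Set ℓ)
-- generalized : joins of non-empty families only (a witness i : I is given)

data Setting : Set where
  plain generalized : Setting

Allowed : ∀ {ℓ} → Setting → Set ℓ → Set ℓ
Allowed plain       I = ⊤
Allowed generalized I = I

record Pomonoid (c ℓ₁ ℓ₂ : Level) : Set (suc (c ⊔ ℓ₁ ⊔ ℓ₂)) where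
  infixl 7 _∙_
  infix 4 _≈_ _≤_
  field
    Carrier        : Set c
    _≈_            : Rel Carrier ℓ₁
    _≤_            : Rel Carrier ℓ₂
    _∙_            : Op₂ Carrier
    ε              : Carrier
    isPartialOrder : IsPartialOrder _≈_ _≤_
    isMonoid       : IsMonoid _≈_ _∙_ ε
    ∙-mono         : ∀ {x y u v} → x ≤ y → u ≤ v → (x ∙ u) ≤ (y ∙ v)

record PomonoidHom {a a₁ a₂ b b₁ b₂}
                   (M : Pomonoid a a₁ a₂) (N : Pomonoid b b₁ b₂)
                   : Set (a ⊔ a₁ ⊔ a₂ ⊔ b ⊔ b₁ ⊔ b₂) where
  private
    module M = Pomonoid M
    module N = Pomonoid N
  field
    fun    : M.Carrier → N.Carrier
    cong   : ∀ {x y} → x M.≈ y → fun x N.≈ fun y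
    mono   : ∀ {x y} → x M.≤ y → fun x N.≤ fun y
    pres-∙ : ∀ x y → fun (x M.∙ y) N.≈ (fun x N.∙ fun y)
    pres-ε : fun M.ε N.≈ N.ε

record MonoMap {a a₁ a₂ b b₁ b₂} (X : Poset a a₁ a₂) (Y : Poset b b₁ b₂)
               : Set (a ⊔ a₂ ⊔ b ⊔ b₂) where
  private
    module X = Poset X
    module Y = Poset Y
  field
    fun  : X.Carrier → Y.Carrier
    mono : ∀ {x y} → x X.≤ y → fun x Y.≤ fun y

mono-cong : ∀ {a a₁ a₂ b b₁ b₂} {X : Poset a a₁ a₂} {Y : Poset b b₁ b₂}
            (f : MonoMap X Y) → ∀ {x y} → Poset._≈_ X x y →
            Poset._≈_ Y (MonoMap.fun f x) (MonoMap.fun f y)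
mono-cong {X = X} {Y = Y} f p =
  Y.antisym (MonoMap.mono f (X.reflexive p)) (MonoMap.mono f (X.reflexive (X.Eq.sym p)))
  where
    module X = Poset X
    module Y = Poset Y

Mon : ∀ {ℓ} → Poset ℓ ℓ ℓ → Pomonoid ℓ ℓ ℓ
Mon {ℓ} X = record
  { Carrier = MonoMap X X
  ; _≈_ = λ f g → ∀ x → fun f x X.≈ fun g x
  ; _≤_ = λ f g → ∀ x → fun f x X.≤ fun g x
  ; _∙_ = comp
  ; ε = idm
  ; isPartialOrder = record
      { isPreorder = record
          { isEquivalence = eqv
          ; reflexive = λ p x → X.reflexive (p x)
          ; trans = λ p q x → X.trans (p x) (q x) }
      ; antisym = λ p q x → X.antisym (p x) (q x) }
  ; isMonoid = record
      { isSemigroup = record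
          { isMagma = record
              { isEquivalence = eqv
              ; ∙-cong = λ {f} {f'} {g} {g'} p q x →
                   X.Eq.trans (mono-cong f (q x)) (p (fun g' x)) }
          ; assoc = λ f g h x → X.Eq.refl }
      ; identity = (λ f x → X.Eq.refl) , (λ f x → X.Eq.refl) }
  ; ∙-mono = λ {f} {f'} {g} {g'} p q x → X.trans (mono f (q x)) (p (fun g' x))
  }
  where
    module X = Poset X
    open MonoMap
    comp : MonoMap X X → MonoMap X X → MonoMap X X
    comp f g = record { fun = fun f ∘ fun g ; mono = mono f ∘ mono g }
    idm : MonoMap X X
    idm = record { fun = id ; mono = id }
    eqv : IsEquivalence (λ (f g : MonoMap X X) → ∀ x → fun f x X.≈ fun g x)
    eqv = record
      { refl = λ x → X.Eq.refl
      ; sym = λ p x → X.Eq.sym (p x)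
      ; trans = λ p q x → X.Eq.trans (p x) (q x) }

record Quantale (s : Setting) (ℓ : Level) : Set (suc ℓ) where
  infixl 6 _+_
  infix 4 _≈_ _≤_
  field
    Carrier        : Set ℓ
    _≈_            : Rel Carrier ℓ
    _≤_            : Rel Carrier ℓ
    isPartialOrder : IsPartialOrder _≈_ _≤_
    ⋁              : (I : Set ℓ) → Allowed s I → (I → Carrier) → Carrier
    ⋁-upper        : ∀ I w (f : I → Carrier) i → f i ≤ ⋁ I w f
    ⋁-least        : ∀ I w (f : I → Carrier) u → (∀ i → f i ≤ u) → ⋁ I w f ≤ u
    _+_            : Op₂ Carrier
    𝟘              : Carrier
    isMonoid       : IsMonoid _≈_ _+_ 𝟘
    +-mono         : ∀ {x y u v} → x ≤ y → u ≤ v → x + u ≤ y + v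
    distribˡ       : ∀ a I w (f : I → Carrier) → a + ⋁ I w f ≈ ⋁ I w (λ i → a + f i)
    distribʳ       : ∀ a I w (f : I → Carrier) → ⋁ I w f + a ≈ ⋁ I w (λ i → f i + a)

  poset : Poset ℓ ℓ ℓ
  poset = record { isPartialOrder = isPartialOrder }

  open IsPartialOrder isPartialOrder public
    using (refl; reflexive; trans; antisym; ≤-respʳ-≈; ≤-respˡ-≈; module Eq)

record Hom {s ℓ} (Q R : Quantale s ℓ) : Set (suc ℓ) where
  private
    module Q = Quantale Q
    module R = Quantale R
  field
    fun    : Q.Carrier → R.Carrier
    cong   : ∀ {x y} → x Q.≈ y → fun x R.≈ fun y
    pres-⋁ : ∀ I w (f : I → Q.Carrier) → fun (Q.⋁ I w f) R.≈ R.⋁ I w (fun ∘ f)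
    pres-+ : ∀ x y → fun (x Q.+ y) R.≈ (fun x R.+ fun y)
    pres-𝟘 : fun Q.𝟘 R.≈ R.𝟘

idHom : ∀ {s ℓ} (Q : Quantale s ℓ) → Hom Q Q
idHom Q = record
  { fun = id ; cong = id
  ; pres-⋁ = λ I w f → Q.Eq.refl
  ; pres-+ = λ x y → Q.Eq.refl
  ; pres-𝟘 = Q.Eq.refl }
  where module Q = Quantale Q

compHom : ∀ {s ℓ} {P Q R : Quantale s ℓ} → Hom Q R → Hom P Q → Hom P R
compHom {P = P} {Q} {R} g f = record
  { fun = G.fun ∘ F.fun
  ; cong = G.cong ∘ F.cong
  ; pres-⋁ = λ I w h → R.Eq.trans (G.cong (F.pres-⋁ I w h)) (G.pres-⋁ I w (F.fun ∘ h))
  ; pres-+ = λ x y → R.Eq.trans (G.cong (F.pres-+ x y)) (G.pres-+ (F.fun x) (F.fun y))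
  ; pres-𝟘 = R.Eq.trans (G.cong F.pres-𝟘) G.pres-𝟘 }
  where
    module R = Quantale R
    module F = Hom f
    module G = Hom g

-- two-element family (used to show homomorphisms are order-preserving)

pairFam : ∀ {ℓ} {A : Set ℓ} → A → A → Lift ℓ Bool → A
pairFam x y (lift true)  = x
pairFam x y (lift false) = y

pairW : ∀ {ℓ} (s : Setting) → Allowed s (Lift ℓ Bool)
pairW plain       = tt
pairW generalized = lift true

hom-mono : ∀ {s ℓ} {Q R : Quantale s ℓ} (f : Hom Q R) →
           ∀ {x y} → Quantale._≤_ Q x y →
           Quantale._≤_ R (Hom.fun f x) (Hom.fun f y)
hom-mono {s} {ℓ} {Q} {R} f {x} {y} x≤y =
  R.≤-respʳ-≈ (R.Eq.trans (R.Eq.sym (F.pres-⋁ B (pairW s) (pairFam x y))) (F.cong J≈y))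
              (R.⋁-upper B (pairW s) (F.fun ∘ pairFam x y) (lift true))
  where
    module Q = Quantale Q
    module R = Quantale R
    module F = Hom f
    B = Lift ℓ Bool
    J≈y : Q.⋁ B (pairW s) (pairFam x y) Q.≈ y
    J≈y = Q.antisym
      (Q.⋁-least B (pairW s) (pairFam x y) y
         (λ { (lift true) → x≤y ; (lift false) → Q.refl }))
      (Q.⋁-upper B (pairW s) (pairFam x y) (lift false))

End : ∀ {s ℓ} → Quantale s ℓ → Pomonoid (suc ℓ) ℓ ℓ
End {s} {ℓ} Q = record
  { Carrier = Hom Q Q
  ; _≈_ = λ f g → ∀ x → Hom.fun f x Q.≈ Hom.fun g x
  ; _≤_ = λ f g → ∀ x → Hom.fun f x Q.≤ Hom.fun g x
  ; _∙_ = compHom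
  ; ε = idHom Q
  ; isPartialOrder = record
      { isPreorder = record
          { isEquivalence = eqv
          ; reflexive = λ p x → Q.reflexive (p x)
          ; trans = λ p q x → Q.trans (p x) (q x) }
      ; antisym = λ p q x → Q.antisym (p x) (q x) }
  ; isMonoid = record
      { isSemigroup = record
          { isMagma = record
              { isEquivalence = eqv
              ; ∙-cong = λ {f} {f'} {g} {g'} p q x →
                   Q.Eq.trans (Hom.cong f (q x)) (p (Hom.fun g' x)) }
          ; assoc = λ f g h x → Q.Eq.refl }
      ; identity = (λ f x → Q.Eq.refl) , (λ f x → Q.Eq.refl) }
  ; ∙-mono = λ {f} {f'} {g} {g'} p q x → Q.trans (hom-mono f (q x)) (p (Hom.fun g' x))
  }
  where
    module Q = Quantale Q
    eqv : IsEquivalence (λ (f g : Hom Q Q) → ∀ x → Hom.fun f x Q.≈ Hom.fun g x)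
    eqv = record
      { refl = λ x → Q.Eq.refl
      ; sym = λ p x → Q.Eq.sym (p x)
      ; trans = λ p q x → Q.Eq.trans (p x) (q x) }

record Iso {s ℓ} (Q R : Quantale s ℓ) : Set (suc ℓ) where
  field
    to       : Hom Q R
    from     : Hom R Q
    from∘to  : ∀ x → Quantale._≈_ Q (Hom.fun from (Hom.fun to x)) x
    to∘from  : ∀ y → Quantale._≈_ R (Hom.fun to (Hom.fun from y)) y

record Subuniverse {s ℓ} (Q : Quantale s ℓ) : Set (suc ℓ) where
  private module Q = Quantale Q
  field
    P        : Q.Carrier → Set ℓ
    closed-⋁ : ∀ I w (f : I → Q.Carrier) → (∀ i → P (f i)) → P (Q.⋁ I w f)
    closed-+ : ∀ {x y} → P x → P y → P (x Q.+ y)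
    closed-𝟘 : P Q.𝟘

Sub : ∀ {s ℓ} (Q : Quantale s ℓ) → Subuniverse Q → Quantale s ℓ
Sub {s} {ℓ} Q S = record
  { Carrier = C
  ; _≈_ = λ x y → proj₁ x Q.≈ proj₁ y
  ; _≤_ = λ x y → proj₁ x Q.≤ proj₁ y
  ; isPartialOrder = record
      { isPreorder = record
          { isEquivalence = eqv
          ; reflexive = Q.reflexive
          ; trans = Q.trans }
      ; antisym = Q.antisym }
  ; ⋁ = λ I w f → Q.⋁ I w (proj₁ ∘ f) , S.closed-⋁ I w (proj₁ ∘ f) (proj₂ ∘ f)
  ; ⋁-upper = λ I w f i → Q.⋁-upper I w (proj₁ ∘ f) i
  ; ⋁-least = λ I w f u → Q.⋁-least I w (proj₁ ∘ f) (proj₁ u)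
  ; _+_ = λ x y → (proj₁ x Q.+ proj₁ y) , S.closed-+ (proj₂ x) (proj₂ y)
  ; 𝟘 = Q.𝟘 , S.closed-𝟘
  ; isMonoid = record
      { isSemigroup = record
          { isMagma = record
              { isEquivalence = eqv
              ; ∙-cong = QM.∙-cong }
          ; assoc = λ x y z → QM.assoc (proj₁ x) (proj₁ y) (proj₁ z) }
      ; identity = (λ x → QM.identityˡ (proj₁ x)) , (λ x → QM.identityʳ (proj₁ x)) }
  ; +-mono = Q.+-mono
  ; distribˡ = λ a I w f → Q.distribˡ (proj₁ a) I w (proj₁ ∘ f)
  ; distribʳ = λ a I w f → Q.distribʳ (proj₁ a) I w (proj₁ ∘ f)
  }
  where
    module Q = Quantale Q
    module QM = IsMonoid Q.isMonoid
    module S = Subuniverse S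
    C = Σ Q.Carrier S.P
    eqv : IsEquivalence (λ (x y : C) → proj₁ x Q.≈ proj₁ y)
    eqv = record { refl = Q.Eq.refl ; sym = Q.Eq.sym ; trans = Q.Eq.trans }

Π : ∀ {s ℓ} (J : Set ℓ) → (J → Quantale s ℓ) → Quantale s ℓ
Π {s} {ℓ} J Qs = record
  { Carrier = C
  ; _≈_ = λ x y → ∀ j → Quantale._≈_ (Qs j) (x j) (y j)
  ; _≤_ = λ x y → ∀ j → Quantale._≤_ (Qs j) (x j) (y j)
  ; isPartialOrder = record
      { isPreorder = record
          { isEquivalence = eqv
          ; reflexive = λ p j → Quantale.reflexive (Qs j) (p j)
          ; trans = λ p q j → Quantale.trans (Qs j) (p j) (q j) }
      ; antisym = λ p q j → Quantale.antisym (Qs j) (p j) (q j) }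
  ; ⋁ = λ I w f j → Quantale.⋁ (Qs j) I w (λ i → f i j)
  ; ⋁-upper = λ I w f i j → Quantale.⋁-upper (Qs j) I w (λ i → f i j) i
  ; ⋁-least = λ I w f u p j → Quantale.⋁-least (Qs j) I w (λ i → f i j) (u j) (λ i → p i j)
  ; _+_ = λ x y j → Quantale._+_ (Qs j) (x j) (y j)
  ; 𝟘 = λ j → Quantale.𝟘 (Qs j)
  ; isMonoid = record
      { isSemigroup = record
          { isMagma = record
              { isEquivalence = eqv
              ; ∙-cong = λ p q j → IsMonoid.∙-cong (Quantale.isMonoid (Qs j)) (p j) (q j) }
          ; assoc = λ x y z j → IsMonoid.assoc (Quantale.isMonoid (Qs j)) (x j) (y j) (z j) }
      ; identity = (λ x j → IsMonoid.identityˡ (Quantale.isMonoid (Qs j)) (x j))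
                 , (λ x j → IsMonoid.identityʳ (Quantale.isMonoid (Qs j)) (x j)) }
  ; +-mono = λ p q j → Quantale.+-mono (Qs j) (p j) (q j)
  ; distribˡ = λ a I w f j → Quantale.distribˡ (Qs j) (a j) I w (λ i → f i j)
  ; distribʳ = λ a I w f j → Quantale.distribʳ (Qs j) (a j) I w (λ i → f i j)
  }
  where
    C = (j : J) → Quantale.Carrier (Qs j)
    eqv : IsEquivalence (λ (x y : C) → ∀ j → Quantale._≈_ (Qs j) (x j) (y j))
    eqv = record
      { refl = λ j → Quantale.Eq.refl (Qs j)
      ; sym = λ p j → Quantale.Eq.sym (Qs j) (p j)
      ; trans = λ p q j → Quantale.Eq.trans (Qs j) (p j) (q j) }

record IsPrevariety {s ℓ k} (K : Quantale s ℓ → Set k) : Set (suc ℓ ⊔ k) where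
  field
    iso-closed  : ∀ {Q R} → K Q → Iso Q R → K R
    sub-closed  : ∀ {Q} (S : Subuniverse Q) → K Q → K (Sub Q S)
    prod-closed : (J : Set ℓ) (Qs : J → Quantale s ℓ) → (∀ j → K (Qs j)) → K (Π J Qs)

record FreeQuantale {s ℓ k} (K : Quantale s ℓ → Set k) (X : Poset ℓ ℓ ℓ)
                    : Set (suc ℓ ⊔ k) where
  field
    F   : Quantale s ℓ
    F∈K : K F
    η   : MonoMap X (Quantale.poset F)
    universal : (Q : Quantale s ℓ) → K Q → (g : MonoMap X (Quantale.poset Q)) →
      Σ (Hom F Q) λ g♯ →
          (∀ x → Quantale._≈_ Q (Hom.fun g♯ (MonoMap.fun η x)) (MonoMap.fun g x))
        × ((g' : Hom F Q) →
             (∀ x → Quantale._≈_ Q (Hom.fun g' (MonoMap.fun η x)) (MonoMap.fun g x)) →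
             ∀ y → Quantale._≈_ Q (Hom.fun g' y) (Hom.fun g♯ y))

-- The action of a ∈ M on F_K(X) is the free extension of η ∘ h(a). Equalities between
-- such extensions follow from uniqueness in the universal property. Monotonicity in a
-- needs more: the set {y | f y ≤ g y} of two homomorphisms is a subalgebra of F_K(X),
-- which lies in K by closure under subalgebras, so η factors through it and, by
-- uniqueness again, the whole of F_K(X) lies in it.
module Submission where

open import Defs
open import Level using (Level)
open import Data.Product using (Σ; _×_; _,_; proj₁; proj₂)
open import Function using (_∘_)
open import Algebra.Structures using (IsMonoid)
open import Relation.Binary.Bundles using (Poset)
import Relation.Binary.Reasoning.PartialOrder as ≤-Reasoning

_∘ₘ_ : ∀ {a b c} {X : Poset a a a} {Y : Poset b b b} {Z : Poset c c c} →
       MonoMap Y Z → MonoMap X Y → MonoMap X Z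
g ∘ₘ f = record { fun = MonoMap.fun g ∘ MonoMap.fun f ; mono = MonoMap.mono g ∘ MonoMap.mono f }

homToMonoMap : ∀ {s ℓ} {Q R : Quantale s ℓ} → Hom Q R → MonoMap (Quantale.poset Q) (Quantale.poset R)
homToMonoMap f = record { fun = Hom.fun f ; mono = hom-mono f }

compPomonoidHom : ∀ {a a₁ a₂ b b₁ b₂ c c₁ c₂}
  {L : Pomonoid a a₁ a₂} {M : Pomonoid b b₁ b₂} {N : Pomonoid c c₁ c₂} →
  PomonoidHom M N → PomonoidHom L M → PomonoidHom L N
compPomonoidHom {N = N} g f = record
  { fun = G.fun ∘ F.fun
  ; cong = G.cong ∘ F.cong
  ; mono = G.mono ∘ F.mono
  ; pres-∙ = λ x y → N.trans (G.cong (F.pres-∙ x y)) (G.pres-∙ (F.fun x) (F.fun y))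
  ; pres-ε = N.trans (G.cong F.pres-ε) G.pres-ε
  }
  where
    module F = PomonoidHom f
    module G = PomonoidHom g
    module N = IsMonoid (Pomonoid.isMonoid N)

module _ {s ℓ} (Q : Quantale s ℓ) where
  open Quantale Q

  ⋁-mono : ∀ I w {f g : I → Carrier} → (∀ i → f i ≤ g i) → ⋁ I w f ≤ ⋁ I w g
  ⋁-mono I w {f} {g} f≤g = ⋁-least I w f _ (λ i → trans (f≤g i) (⋁-upper I w g i))

  subInclusion : (S : Subuniverse Q) → Hom (Sub Q S) Q
  subInclusion S = record
    { fun = proj₁
    ; cong = λ x≈y → x≈y
    ; pres-⋁ = λ I w f → Eq.refl
    ; pres-+ = λ x y → Eq.refl
    ; pres-𝟘 = Eq.refl
    }

hom-≤-subuniverse : ∀ {s ℓ} {Q R : Quantale s ℓ} → Hom Q R → Hom Q R → Subuniverse Q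
hom-≤-subuniverse {Q = Q} {R} f g = record
  { P = λ z → f.fun z R.≤ g.fun z
  ; closed-⋁ = λ I w h fh≤gh → begin
      f.fun (Q.⋁ I w h)      ≈⟨ f.pres-⋁ I w h ⟩
      R.⋁ I w (f.fun ∘ h)   ≤⟨ ⋁-mono R I w fh≤gh ⟩
      R.⋁ I w (g.fun ∘ h)   ≈⟨ g.pres-⋁ I w h ⟨
      g.fun (Q.⋁ I w h)      ∎
  ; closed-+ = λ {x} {y} fx≤gx fy≤gy → begin
      f.fun (x Q.+ y)         ≈⟨ f.pres-+ x y ⟩
      f.fun x R.+ f.fun y     ≤⟨ R.+-mono fx≤gx fy≤gy ⟩
      g.fun x R.+ g.fun y     ≈⟨ g.pres-+ x y ⟨
      g.fun (x Q.+ y)         ∎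
  ; closed-𝟘 = R.reflexive (R.Eq.trans f.pres-𝟘 (R.Eq.sym g.pres-𝟘))
  }
  where
    module Q = Quantale Q
    module R = Quantale R
    module f = Hom f
    module g = Hom g
    open ≤-Reasoning R.poset

module FreeQuantaleProperties {s ℓ ℓk} {K : Quantale s ℓ → Set ℓk} {X : Poset ℓ ℓ ℓ}
                              (FX : FreeQuantale K X) where
  open FreeQuantale FX
  private
    module F = Quantale F
    ηf = MonoMap.fun η

  module _ (Q : Quantale s ℓ) (Q∈K : K Q) (g : MonoMap X (Quantale.poset Q)) where
    private module Q = Quantale Q

    extend : Hom F Q
    extend = proj₁ (universal Q Q∈K g)

    extend-η : ∀ x → Hom.fun extend (ηf x) Q.≈ MonoMap.fun g x
    extend-η = proj₁ (proj₂ (universal Q Q∈K g))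

    extend-unique : (g' : Hom F Q) → (∀ x → Hom.fun g' (ηf x) Q.≈ MonoMap.fun g x) →
                    ∀ y → Hom.fun g' y Q.≈ Hom.fun extend y
    extend-unique = proj₂ (proj₂ (universal Q Q∈K g))

  hom-ext : ∀ {Q : Quantale s ℓ} → K Q → (f g : Hom F Q) →
            (∀ x → Quantale._≈_ Q (Hom.fun f (ηf x)) (Hom.fun g (ηf x))) →
            ∀ y → Quantale._≈_ Q (Hom.fun f y) (Hom.fun g y)
  hom-ext {Q} Q∈K f g fη≈gη y =
    Q.Eq.trans (unique f (λ x → Q.Eq.refl) y) (Q.Eq.sym (unique g (Q.Eq.sym ∘ fη≈gη) y))
    where
      module Q = Quantale Q
      unique : (g' : Hom F Q) → (∀ x → Hom.fun g' (ηf x) Q.≈ Hom.fun f (ηf x)) →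
               ∀ y → Hom.fun g' y Q.≈ Hom.fun (extend Q Q∈K (homToMonoMap f ∘ₘ η)) y
      unique = extend-unique Q Q∈K (homToMonoMap f ∘ₘ η)

  hom-ext-≤ : IsPrevariety K → ∀ {Q : Quantale s ℓ} (f g : Hom F Q) →
              (∀ x → Quantale._≤_ Q (Hom.fun f (ηf x)) (Hom.fun g (ηf x))) →
              ∀ y → Quantale._≤_ Q (Hom.fun f y) (Hom.fun g y)
  hom-ext-≤ PV {Q} f g fη≤gη y = begin
      Hom.fun f y       ≈⟨ Hom.cong f y≈ ⟨
      Hom.fun f (ι y)   ≤⟨ proj₂ (Hom.fun corestriction y) ⟩
      Hom.fun g (ι y)   ≈⟨ Hom.cong g y≈ ⟩
      Hom.fun g y       ∎
    where
      open ≤-Reasoning (Quantale.poset Q)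
      S : Subuniverse F
      S = hom-≤-subuniverse f g

      SF∈K : K (Sub F S)
      SF∈K = IsPrevariety.sub-closed PV S F∈K

      ηS : MonoMap X (Quantale.poset (Sub F S))
      ηS = record { fun = λ x → ηf x , fη≤gη x ; mono = MonoMap.mono η }

      corestriction : Hom F (Sub F S)
      corestriction = extend (Sub F S) SF∈K ηS

      ι : F.Carrier → F.Carrier
      ι = Hom.fun (compHom (subInclusion F S) corestriction)

      y≈ : ι y F.≈ y
      y≈ = hom-ext F∈K (compHom (subInclusion F S) corestriction) (idHom F)
             (extend-η (Sub F S) SF∈K ηS) y

  endo : MonoMap X X → Hom F F
  endo φ = extend F F∈K (η ∘ₘ φ)

  endo-η : ∀ φ x → Hom.fun (endo φ) (ηf x) F.≈ ηf (MonoMap.fun φ x)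
  endo-η φ = extend-η F F∈K (η ∘ₘ φ)

  endoPomonoidHom : IsPrevariety K → PomonoidHom (Mon X) (End F)
  endoPomonoidHom PV = record
    { fun = endo
    ; cong = λ {φ} {ψ} φ≈ψ → hom-ext F∈K (endo φ) (endo ψ) λ x → begin-equality
        Hom.fun (endo φ) (ηf x)   ≈⟨ endo-η φ x ⟩
        ηf (MonoMap.fun φ x)      ≈⟨ mono-cong η (φ≈ψ x) ⟩
        ηf (MonoMap.fun ψ x)      ≈⟨ endo-η ψ x ⟨
        Hom.fun (endo ψ) (ηf x)   ∎
    ; mono = λ {φ} {ψ} φ≤ψ → hom-ext-≤ PV (endo φ) (endo ψ) λ x → begin
        Hom.fun (endo φ) (ηf x)   ≈⟨ endo-η φ x ⟩
        ηf (MonoMap.fun φ x)      ≤⟨ MonoMap.mono η (φ≤ψ x) ⟩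
        ηf (MonoMap.fun ψ x)      ≈⟨ endo-η ψ x ⟨
        Hom.fun (endo ψ) (ηf x)   ∎
    ; pres-∙ = λ φ ψ → hom-ext F∈K (endo (φ ∘ₘ ψ)) (compHom (endo φ) (endo ψ)) λ x → begin-equality
        Hom.fun (endo (φ ∘ₘ ψ)) (ηf x)                  ≈⟨ endo-η (φ ∘ₘ ψ) x ⟩
        ηf (MonoMap.fun φ (MonoMap.fun ψ x))            ≈⟨ endo-η φ (MonoMap.fun ψ x) ⟨
        Hom.fun (endo φ) (ηf (MonoMap.fun ψ x))         ≈⟨ Hom.cong (endo φ) (endo-η ψ x) ⟨
        Hom.fun (endo φ) (Hom.fun (endo ψ) (ηf x))      ∎
    ; pres-ε = hom-ext F∈K (endo (Pomonoid.ε (Mon X))) (idHom F) (endo-η (Pomonoid.ε (Mon X)))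
    }
    where open ≤-Reasoning F.poset

lemma3p3 : {s : Setting} {ℓ ℓk m m₁ m₂ : Level}
    (K : Quantale s ℓ → Set ℓk) → IsPrevariety K →
    (M : Pomonoid m m₁ m₂) (X : Poset ℓ ℓ ℓ) (h : PomonoidHom M (Mon X)) →
    (FX : FreeQuantale K X) →
    Σ (PomonoidHom M (End (FreeQuantale.F FX))) λ h♯ →
        ((a : Pomonoid.Carrier M) (x : Poset.Carrier X) →
          Quantale._≈_ (FreeQuantale.F FX)
            (Hom.fun (PomonoidHom.fun h♯ a) (MonoMap.fun (FreeQuantale.η FX) x))
            (MonoMap.fun (FreeQuantale.η FX) (MonoMap.fun (PomonoidHom.fun h a) x)))
      × ((κ : Pomonoid.Carrier M → Hom (FreeQuantale.F FX) (FreeQuantale.F FX)) →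
          ((a : Pomonoid.Carrier M) (x : Poset.Carrier X) →
            Quantale._≈_ (FreeQuantale.F FX)
              (Hom.fun (κ a) (MonoMap.fun (FreeQuantale.η FX) x))
              (MonoMap.fun (FreeQuantale.η FX) (MonoMap.fun (PomonoidHom.fun h a) x))) →
          (a : Pomonoid.Carrier M) (y : Quantale.Carrier (FreeQuantale.F FX)) →
          Quantale._≈_ (FreeQuantale.F FX) (Hom.fun (κ a) y) (Hom.fun (PomonoidHom.fun h♯ a) y))
lemma3p3 K PV M X h FX =
    compPomonoidHom (endoPomonoidHom PV) h
  , (λ a → endo-η (PomonoidHom.fun h a))
  , (λ κ κη a → extend-unique F F∈K (η ∘ₘ PomonoidHom.fun h a) (κ a) (κη a))
  where
    open FreeQuantale FX
    open FreeQuantaleProperties FX
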